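{- Let $\mathcal{P}$ be a $\delta^+$-common vertex property with associated integer $d(\mathcal{P})$, let $k\geq 1$ and $\ell\geq 2$ be integers, and let $G$ be a finite digraph with $\delta^+(G)\geq d(\mathcal{P})+2k\ell^k$. Then $G$ contains a subgraph $B$ isomorphic to $B^+_{k,\ell}$ such that every leaf of $B$ satisfies $\mathcal{P}$ in $G$.
   Context: All digraphs are finite, without loops or multiple copies of the same edge (two oppositely oriented edges between a pair of vertices are allowed). $\delta^+(G)$ is the minimum out-degree of $G$. A vertex property $\mathcal{P}$ is a property of pairs (digraph $G$, vertex $v$ of $G$); we say $v$ satisfies $\mathcal{P}$ in $G$. $\mathcal{P}$ is $\delta^+$-common if (i) there is an integer $d=d(\mathcal{P})$ such that every digraph $G$ with $\delta^+(G)\geq d$ contains a vertex satisfying $\mathcal{P}$ in $G$, and (ii) $\mathcal{P}$ is anti-monotone: if $H$ is a subgraph of $G$ and $v\in V(H)$ satisfies $\mathcal{P}$ in $H$, then $v$ satisfies $\mathcal{P}$ in $G$. $B^+_{k,\ell}$ is the complete $\ell$-ary tree of depth $k$ with all edges oriented away from the root; its leaves are the $\ell^k$ vertices at distance $k$ from the root. -}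

module Defs where

open import Data.Nat using (ℕ; _≤_; _+_; _*_; _^_)
open import Data.Bool using (Bool; T)
open import Data.Fin using (Fin)
open import Data.List using (List; []; _∷_; length; filter)
open import Data.List.Membership.Propositional using (_∈_)
open import Data.List.Relation.Unary.Unique.Propositional using (Unique)
open import Data.Product using (Σ; ∃; ∃-syntax; _×_; _,_; proj₁)
open import Relation.Nullary using (¬_)
open import Relation.Binary.PropositionalEquality using (_≡_; _≢_)
open import Data.Bool.Properties using (T?)

-- A finite digraph: vertices form a finite set of natural numbers (a
-- duplicate-free list), edges are given by a Boolean adjacency relation
-- (so no multiple copies of the same edge; both u→w and w→u allowed),
-- every edge joins two vertices, and there are no loops.
record Digraph : Set where
  field
    V        : List ℕ
    V-unique : Unique V
    E        : ℕ → ℕ → Bool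
    E-closed : ∀ u w → T (E u w) → (u ∈ V) × (w ∈ V)
    loopless : ∀ v → ¬ T (E v v)
open Digraph public

outdeg : Digraph → ℕ → ℕ
outdeg G v = length (filter (λ w → T? (E G v w)) (V G))

-- δ⁺(G) ≥ m   (digraphs considered have at least one vertex, so that the
-- minimum out-degree is defined)
MinOutDeg≥ : Digraph → ℕ → Set
MinOutDeg≥ G m = (V G ≢ []) × (∀ v → v ∈ V G → m ≤ outdeg G v)

_⊆G_ : Digraph → Digraph → Set
H ⊆G G = (∀ v → v ∈ V H → v ∈ V G) × (∀ u w → T (E H u w) → T (E G u w))

VertexProperty : Set₁
VertexProperty = Digraph → ℕ → Set

IsδCommon : VertexProperty → ℕ → Set
IsδCommon P d =
  (∀ G → MinOutDeg≥ G d → ∃[ v ] (v ∈ V G × P G v))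
  × (∀ H G → H ⊆G G → ∀ v → v ∈ V H → P H v → P G v)

-- The complete ℓ-ary out-tree B⁺_{k,ℓ} of depth k: vertices are words over
-- Fin ℓ of length ≤ k (the root is the empty word), with an edge from x to
-- i ∷ x for each letter i.
TVert : ℕ → ℕ → Set
TVert k ℓ = Σ (List (Fin ℓ)) (λ w → length w ≤ k)

TEdge : ∀ {k ℓ} → TVert k ℓ → TVert k ℓ → Set
TEdge {ℓ = ℓ} x y = ∃[ i ] (proj₁ y ≡ (i ∷ proj₁ x))

IsLeaf : ∀ {k ℓ} → TVert k ℓ → Set
IsLeaf {k} x = length (proj₁ x) ≡ k

IsIsoFromTree : (k ℓ : ℕ) → (B : Digraph) → (TVert k ℓ → ℕ) → Set
IsIsoFromTree k ℓ B φ =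
  (∀ x → φ x ∈ V B)
  × (∀ x y → φ x ≡ φ y → proj₁ x ≡ proj₁ y)
  × (∀ v → v ∈ V B → ∃[ x ] (φ x ≡ v))
  × (∀ x y → (T (E B (φ x) (φ y)) → TEdge x y) × (TEdge x y → T (E B (φ x) (φ y))))

{-# OPTIONS --safe #-}
-- Fix a list X of vertices known to satisfy P, put N = 2ℓᵏ, and let A₀ = X and
-- A_{j+1} be the set of vertices with at least N out-neighbours in A_j.  If A_k has
-- a vertex, a copy of B⁺_{k,ℓ} rooted there with leaves in X is built greedily:
-- B⁺_{k,ℓ} has fewer than N vertices.  Otherwise a vertex outside
-- U = A₀ ∪ … ∪ A_{k-1} has fewer than N out-neighbours in each A_j, so, as
-- δ⁺(G) ≥ d + kN, at least d out-neighbours outside U; thus δ⁺(G − U) ≥ d.  The same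
-- count for the unions A_i ∪ … ∪ A_{k-1}, i = k, k-1, …, 0, shows that G − U is
-- nonempty: a vertex outside one union has an out-neighbour outside the next.  By
-- δ⁺-commonness G − U, hence G, has a vertex satisfying P, which is not in X ⊆ U.
-- Adding it to X and repeating, the process stops after at most |V(G)| rounds.
module Submission where

open import Data.Bool using (Bool; true; false; T; not; _∧_; _∨_)
open import Data.Bool.Properties using (T?; T-∧; T-∨; T-≡; ∧-distribˡ-∨)
open import Data.Empty using (⊥)
open import Data.Fin using (Fin; zero; suc)
open import Data.List
  using (List; []; _∷_; length; filter; map; _++_; _∷ʳ_; reverse; cartesianProductWith; allFin; deduplicate)
open import Data.List.Membership.Propositional using (_∈_; _∉_; find; lose)
open import Data.List.Membership.Propositional.Properties
  using (∈-filter⁺; ∈-filter⁻; ∈-map⁺; ∈-map⁻; ∈-++⁺ˡ; ∈-++⁺ʳ; ∈-allFin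
        ; ∈-cartesianProductWith⁺; ∈-cartesianProductWith⁻; ∈-deduplicate⁺; ∈-deduplicate⁻)
open import Data.List.Properties
  using (filter-notAll; filter-none; length-++; length-map; length-tabulate
        ; length-reverse; reverse-injective; unfold-reverse)
open import Data.List.Relation.Binary.Subset.Propositional using (_⊆_)
import Data.List.Relation.Binary.Sublist.Propositional as Sublist
import Data.List.Relation.Binary.Sublist.Propositional.Properties as Sublist
open import Data.List.Relation.Unary.All as All using (all?)
open import Data.List.Relation.Unary.All.Properties using (¬All⇒Any¬; ¬Any⇒All¬)
open import Data.List.Relation.Unary.AllPairs using ([]; _∷_)
open import Data.List.Relation.Unary.Any as Any using (here; there; any?)
open import Data.List.Relation.Unary.Unique.Propositional using (Unique)
import Data.List.Relation.Unary.Unique.Propositional.Properties as Unique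
open import Data.Nat using (ℕ; zero; suc; _≤_; _<_; _+_; _*_; _^_; z≤n; s≤s; _≤ᵇ_; _≟_)
open import Data.Nat.Properties
open import Algebra.Properties.CommutativeSemigroup +-commutativeSemigroup using (xy∙z≈y∙xz; xy∙z≈xz∙y)
open import Algebra.Properties.CommutativeSemigroup *-commutativeSemigroup using (x∙yz≈y∙xz)
open import Data.List.Relation.Unary.Unique.DecPropositional.Properties _≟_ using (deduplicate-!)
open import Data.Product using (∃-syntax; _×_; _,_; proj₁; proj₂)
open import Data.Sum using (_⊎_; inj₁; inj₂)
open import Function using (id; _∘_; Equivalence)
open import Relation.Binary.Definitions using (DecidableEquality)
open import Relation.Binary.PropositionalEquality
open import Relation.Nullary using (¬_; Dec; yes; no; contradiction; ¬?)
open import Relation.Nullary.Decidable using (⌊_⌋; toWitness; fromWitness; _×-dec_)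

open import Defs

open Equivalence using (to; from)

count : {A : Set} → (A → Bool) → List A → ℕ
count f xs = length (filter (T? ∘ f) xs)

module _ {A : Set} where

  count-mono : {f g : A → Bool} → (∀ x → T (f x) → T (g x)) → ∀ xs → count f xs ≤ count g xs
  count-mono {f} {g} f⇒g xs =
    Sublist.length-mono-≤
      (Sublist.filter⁺ (T? ∘ f) (T? ∘ g) (λ { refl → f⇒g _ }) (Sublist.⊆-refl {x = xs}))

  count-∨ : (f g : A → Bool) → ∀ xs → count (λ x → f x ∨ g x) xs ≤ count f xs + count g xs
  count-∨ f g [] = z≤n
  count-∨ f g (x ∷ xs) with f x | g x | count-∨ f g xs
  ... | true  | true  | ih = s≤s (≤-trans ih (+-monoʳ-≤ (count f xs) (n≤1+n _)))
  ... | true  | false | ih = s≤s ih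
  ... | false | true  | ih = ≤-trans (s≤s ih) (≤-reflexive (sym (+-suc _ _)))
  ... | false | false | ih = ih

  count-filter : {f g : A → Bool} → (∀ x → T (f x) → T (g x)) →
                 ∀ xs → count f (filter (T? ∘ g) xs) ≡ count f xs
  count-filter f⇒g [] = refl
  count-filter {f} {g} f⇒g (x ∷ xs) with g x in gx
  ... | true with f x
  ...   | true  = cong suc (count-filter f⇒g xs)
  ...   | false = count-filter f⇒g xs
  count-filter {f} {g} f⇒g (x ∷ xs) | false with f x in fx
  ... | true  = contradiction (subst T gx (f⇒g x (subst T (sym fx) _))) λ ()
  ... | false = count-filter f⇒g xs

module _ {A : Set} (_≟_ : DecidableEquality A) where

  open import Data.List.Membership.DecPropositional _≟_ using (_∈?_)

  Unique⇒length-≤ : {xs ys : List A} → Unique xs → xs ⊆ ys → length xs ≤ length ys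
  Unique⇒length-≤ {[]} _ _ = z≤n
  Unique⇒length-≤ {x ∷ xs} {ys} (x∉xs ∷ u) xs⊆ys = begin
    suc (length xs)             ≤⟨ s≤s (Unique⇒length-≤ u xs⊆ys-x) ⟩
    suc (length (filter ≢x ys)) ≤⟨ filter-notAll ≢x ys (Any.map (λ x≡y x≢y → x≢y x≡y) x∈ys) ⟩
    length ys                   ∎
    where
    open ≤-Reasoning
    ≢x = ¬? ∘ (x ≟_)
    xs⊆ys-x : xs ⊆ filter ≢x ys
    xs⊆ys-x y∈xs = ∈-filter⁺ ≢x (xs⊆ys (there y∈xs)) (All.lookup x∉xs y∈xs)
    x∈ys : x ∈ ys
    x∈ys = xs⊆ys (here refl)

  ∃-fresh : {xs ys : List A} → Unique xs → length ys < length xs → ∃[ x ] (x ∈ xs × x ∉ ys)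
  ∃-fresh {xs} {ys} u ys<xs with all? (_∈? ys) xs
  ... | yes xs⊆ys = contradiction (Unique⇒length-≤ u (All.lookup xs⊆ys)) (<⇒≱ ys<xs)
  ... | no xs⊈ys = find (¬All⇒Any¬ (_∈? ys) xs xs⊈ys)

T-not⁺ : ∀ {b} → ¬ T b → T (not b)
T-not⁺ {false} _  = _
T-not⁺ {true}  ¬b = ¬b _

T-not⁻ : ∀ {b} → T (not b) → ¬ T b
T-not⁻ {false} _ ()

nonempty-∈ : {A : Set} {xs : List A} → xs ≢ [] → ∃[ x ] x ∈ xs
nonempty-∈ {xs = []}    xs≢[] = contradiction refl xs≢[]
nonempty-∈ {xs = x ∷ _} _     = x , here refl

degIn : Digraph → (ℕ → Bool) → ℕ → ℕ
degIn G S v = count (λ w → E G v w ∧ S w) (V G)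

induced : (G : Digraph) → (ℕ → Bool) → Digraph
induced G S = record
  { V        = filter (T? ∘ S) (V G)
  ; V-unique = Unique.filter⁺ (T? ∘ S) (V-unique G)
  ; E        = λ u w → S u ∧ (E G u w ∧ S w)
  ; E-closed = closed
  ; loopless = λ v e → loopless G v (proj₁ (to T-∧ (proj₂ (to (T-∧ {S v}) e))))
  }
  where
  closed : ∀ u w → T (S u ∧ (E G u w ∧ S w)) → (u ∈ _) × (w ∈ _)
  closed u w e =
    let Su , e′ = to (T-∧ {S u}) e
        Euw , Sw = to T-∧ e′
        u∈V , w∈V = E-closed G u w Euw
    in ∈-filter⁺ (T? ∘ S) u∈V Su , ∈-filter⁺ (T? ∘ S) w∈V Sw

module _ (G : Digraph) (S : ℕ → Bool) where

  induced-⊆G : induced G S ⊆G G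
  induced-⊆G = (λ v v∈ → proj₁ (∈-filter⁻ (T? ∘ S) v∈))
             , (λ u w e → proj₁ (to T-∧ (proj₂ (to (T-∧ {S u}) e))))

  ∈-induced⁺ : ∀ {v} → v ∈ V G → T (S v) → v ∈ V (induced G S)
  ∈-induced⁺ = ∈-filter⁺ (T? ∘ S)

  ∈-induced⁻ : ∀ {v} → v ∈ V (induced G S) → v ∈ V G × T (S v)
  ∈-induced⁻ = ∈-filter⁻ (T? ∘ S)

  outdeg-induced : ∀ {v} → T (S v) → outdeg (induced G S) v ≡ degIn G S v
  outdeg-induced {v} Sv rewrite to T-≡ Sv =
    count-filter (λ w e → proj₂ (to T-∧ e)) (V G)

degIn-∅ : ∀ G v → degIn G (λ _ → false) v ≡ 0
degIn-∅ G v =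
  cong length (filter-none (T? ∘ ES) (All.universal (λ w → proj₂ ∘ to (T-∧ {E G v w})) (V G)))
  where
  ES : ℕ → Bool
  ES w = E G v w ∧ false

module _ (G : Digraph) where

  degIn-∪ : ∀ S S′ v → degIn G (λ w → S w ∨ S′ w) v ≤ degIn G S v + degIn G S′ v
  degIn-∪ S S′ v = ≤-trans
    (count-mono (λ w → subst T (∧-distribˡ-∨ (E G v w) (S w) (S′ w))) (V G))
    (count-∨ (λ w → E G v w ∧ S w) (λ w → E G v w ∧ S′ w) (V G))

  outdeg-split : ∀ S v → outdeg G v ≤ degIn G S v + degIn G (not ∘ S) v
  outdeg-split S v = ≤-trans
    (count-mono (λ w → split (E G v w) (S w)) (V G))
    (count-∨ (λ w → E G v w ∧ S w) (λ w → E G v w ∧ not (S w)) (V G))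
    where
    split : ∀ e s → T e → T ((e ∧ s) ∨ (e ∧ not s))
    split true true  _ = _
    split true false _ = _

  fresh-out-neighbour : ∀ S v (F : List ℕ) → length F < degIn G S v →
                        ∃[ w ] (w ∉ F × T (E G v w) × T (S w))
  fresh-out-neighbour S v F F<deg =
    let w , w∈ , w∉F = ∃-fresh _≟_ (Unique.filter⁺ (T? ∘ ES) (V-unique G)) F<deg
        Evw , Sw = to T-∧ (proj₂ (∈-filter⁻ (T? ∘ ES) {xs = V G} w∈))
    in w , w∉F , Evw , Sw
    where
    ES : ℕ → Bool
    ES w = E G v w ∧ S w

length-cartesianProductWith : {A B C : Set} (f : A → B → C) (xs : List A) (ys : List B) →
                              length (cartesianProductWith f xs ys) ≡ length xs * length ys
length-cartesianProductWith f [] ys = refl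
length-cartesianProductWith f (x ∷ xs) ys = begin
  length (map (f x) ys ++ cartesianProductWith f xs ys)  ≡⟨ length-++ (map (f x) ys) ⟩
  length (map (f x) ys) + length (cartesianProductWith f xs ys)
    ≡⟨ cong₂ _+_ (length-map (f x) ys) (length-cartesianProductWith f xs ys) ⟩
  length ys + length xs * length ys ∎
  where open ≡-Reasoning

words : (ℓ j : ℕ) → List (List (Fin ℓ))
words ℓ zero    = [] ∷ []
words ℓ (suc j) = [] ∷ cartesianProductWith _∷_ (allFin ℓ) (words ℓ j)

module _ {ℓ : ℕ} where

  ∈-words⁺ : ∀ {j} (x : List (Fin ℓ)) → length x ≤ j → x ∈ words ℓ j
  ∈-words⁺ {zero}  []      _       = here refl
  ∈-words⁺ {suc j} []      _       = here refl
  ∈-words⁺ {suc j} (i ∷ x) (s≤s l) =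
    there (∈-cartesianProductWith⁺ _∷_ (∈-allFin i) (∈-words⁺ x l))

  ∈-words⁻ : ∀ {j} {x : List (Fin ℓ)} → x ∈ words ℓ j → length x ≤ j
  ∈-words⁻ {zero}  (here refl) = z≤n
  ∈-words⁻ {suc j} (here refl) = z≤n
  ∈-words⁻ {suc j} (there x∈) with ∈-cartesianProductWith⁻ _∷_ (allFin ℓ) (words ℓ j) x∈
  ... | _ , _ , _ , y∈ , refl = s≤s (∈-words⁻ y∈)

0<length-words : ∀ ℓ j → 0 < length (words ℓ j)
0<length-words ℓ zero    = s≤s z≤n
0<length-words ℓ (suc j) = s≤s z≤n

length-words-suc : ∀ ℓ j → length (words ℓ (suc j)) ≡ suc (ℓ * length (words ℓ j))
length-words-suc ℓ j = cong suc (trans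
  (length-cartesianProductWith _∷_ (allFin ℓ) (words ℓ j))
  (cong (_* length (words ℓ j)) (length-tabulate {n = ℓ} id)))

length-words-< : ∀ {ℓ} → 2 ≤ ℓ → ∀ j → length (words ℓ j) < 2 * ℓ ^ j
length-words-< ℓ≥2 zero = s≤s (s≤s z≤n)
length-words-< {ℓ} ℓ≥2 (suc j) = begin
  suc (length (words ℓ (suc j)))  ≡⟨ cong suc (length-words-suc ℓ j) ⟩
  2 + ℓ * W                       ≤⟨ +-monoˡ-≤ (ℓ * W) ℓ≥2 ⟩
  ℓ + ℓ * W                       ≡⟨ *-suc ℓ W ⟨
  ℓ * suc W                       ≤⟨ *-monoʳ-≤ ℓ (length-words-< ℓ≥2 j) ⟩
  ℓ * (2 * ℓ ^ j)                 ≡⟨ x∙yz≈y∙xz ℓ 2 (ℓ ^ j) ⟩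
  2 * (ℓ * ℓ ^ j)                 ∎
  where
  open ≤-Reasoning
  W = length (words ℓ j)

TreeCopy : (k ℓ : ℕ) → Digraph → (ℕ → Set) → Set
TreeCopy k ℓ G L =
  ∃[ B ] (B ⊆G G × ∃[ φ ] (IsIsoFromTree k ℓ B φ × (∀ x → IsLeaf {k} {ℓ} x → L (φ x))))

record Embedding (k ℓ : ℕ) (G : Digraph) : Set where
  field
    vertex    : List (Fin ℓ) → ℕ
    root∈V    : vertex [] ∈ V G
    injective : ∀ x y → length x ≤ k → length y ≤ k → vertex x ≡ vertex y → x ≡ y
    edge      : ∀ i x → length (i ∷ x) ≤ k → T (E G (vertex x) (vertex (i ∷ x)))

module Image {k ℓ : ℕ} {G : Digraph} (e : Embedding k ℓ G) where

  open Embedding e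

  vertex∈V : ∀ x → length x ≤ k → vertex x ∈ V G
  vertex∈V []      _ = root∈V
  vertex∈V (i ∷ x) l = proj₂ (E-closed G _ _ (edge i x l))

  ChildEdge : ℕ → ℕ → List (Fin ℓ) → Set
  ChildEdge u w []      = ⊥
  ChildEdge u w (i ∷ x) = vertex x ≡ u × vertex (i ∷ x) ≡ w

  childEdge? : ∀ u w y → Dec (ChildEdge u w y)
  childEdge? u w []      = no λ ()
  childEdge? u w (i ∷ x) = (vertex x ≟ u) ×-dec (vertex (i ∷ x) ≟ w)

  VB : List ℕ
  VB = deduplicate _≟_ (map vertex (words ℓ k))

  EB : ℕ → ℕ → Bool
  EB u w = ⌊ any? (childEdge? u w) (words ℓ k) ⌋

  ∈-VB⁺ : ∀ x → length x ≤ k → vertex x ∈ VB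
  ∈-VB⁺ x l = ∈-deduplicate⁺ _≟_ (∈-map⁺ vertex (∈-words⁺ x l))

  ∈-VB⁻ : ∀ {u} → u ∈ VB → ∃[ x ] (length x ≤ k × vertex x ≡ u)
  ∈-VB⁻ u∈ with ∈-map⁻ vertex (∈-deduplicate⁻ _≟_ _ u∈)
  ... | x , x∈ , refl = x , ∈-words⁻ x∈ , refl

  EB⁺ : ∀ i x → length (i ∷ x) ≤ k → T (EB (vertex x) (vertex (i ∷ x)))
  EB⁺ i x l = fromWitness (lose (∈-words⁺ (i ∷ x) l) (refl , refl))

  EB⁻ : ∀ {u w} → T (EB u w) →
        ∃[ i ] ∃[ x ] (length (i ∷ x) ≤ k × vertex x ≡ u × vertex (i ∷ x) ≡ w)
  EB⁻ {u} {w} e with find (toWitness e)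
  ... | i ∷ x , y∈ , x↦u , y↦w = i , x , ∈-words⁻ y∈ , x↦u , y↦w

  EB-closed : ∀ u w → T (EB u w) → u ∈ VB × w ∈ VB
  EB-closed u w e with EB⁻ e
  ... | i , x , l , refl , refl = ∈-VB⁺ x (≤-trans (n≤1+n _) l) , ∈-VB⁺ (i ∷ x) l

  EB-loopless : ∀ v → ¬ T (EB v v)
  EB-loopless v e with EB⁻ e
  ... | i , x , l , x↦v , y↦v =
    1+n≢n (cong length (sym (injective x (i ∷ x) (≤-trans (n≤1+n _) l) l (trans x↦v (sym y↦v)))))

  B : Digraph
  B = record
    { V        = VB
    ; V-unique = deduplicate-! (map vertex (words ℓ k))
    ; E        = EB
    ; E-closed = EB-closed
    ; loopless = EB-loopless
    }

  B⊆G : B ⊆G G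
  B⊆G = vertices , edges
    where
    vertices : ∀ u → u ∈ VB → u ∈ V G
    vertices u u∈ with ∈-VB⁻ u∈
    ... | x , l , refl = vertex∈V x l
    edges : ∀ u w → T (EB u w) → T (E G u w)
    edges u w e with EB⁻ e
    ... | i , x , l , refl , refl = edge i x l

  B≅tree : IsIsoFromTree k ℓ B (vertex ∘ proj₁)
  B≅tree = (λ (x , l) → ∈-VB⁺ x l)
         , (λ (x , lx) (y , ly) → injective x y lx ly)
         , (λ v v∈ → let x , l , x↦v = ∈-VB⁻ v∈ in (x , l) , x↦v)
         , λ x y → reflects-edge x y , preserves-edge x y
    where
    reflects-edge : ∀ x y → T (EB (vertex (proj₁ x)) (vertex (proj₁ y))) → TEdge x y
    reflects-edge (x , lx) (y , ly) e with EB⁻ e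
    ... | i , x′ , l , x′↦ , y′↦
        with injective x′ x (≤-trans (n≤1+n _) l) lx x′↦ | injective (i ∷ x′) y l ly y′↦
    ...   | refl | refl = i , refl
    preserves-edge : ∀ x y → TEdge x y → T (EB (vertex (proj₁ x)) (vertex (proj₁ y)))
    preserves-edge (x , _) (_ , ly) (i , refl) = EB⁺ i x ly

embedding⇒copy : ∀ {k ℓ G} {L : ℕ → Set} (e : Embedding k ℓ G) →
                 (∀ x → length x ≡ k → L (Embedding.vertex e x)) → TreeCopy k ℓ G L
embedding⇒copy e leaf = B , B⊆G , vertex ∘ proj₁ , B≅tree , λ (x , _) → leaf x
  where
  open Embedding e
  open Image e

module Greedy (G : Digraph) (ℓ N : ℕ) (A : ℕ → ℕ → Bool)
              (A-deg : ∀ j v → T (A (suc j) v) → N ≤ degIn G (A j) v) where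

  -- Tree vertices are addressed by paths from the root (the children of p are p ∷ʳ i),
  -- the reverse of the word encoding of Defs; `embedding` converts between the two.
  record Tree (j v : ℕ) (F : List ℕ) : Set where
    field
      label     : List (Fin ℓ) → ℕ
      root      : label [] ≡ v
      avoids    : ∀ p → length p ≤ j → label p ∉ F
      injective : ∀ p q → length p ≤ j → length q ≤ j → label p ≡ label q → p ≡ q
      edge      : ∀ p i → length p < j → T (E G (label p) (label (p ∷ʳ i)))
      leaf      : ∀ p → length p ≡ j → T (A 0 (label p))

  open Tree

  labels : ∀ {j v F} → Tree j v F → List ℕ
  labels {j} t = map (label t) (words ℓ j)

  record Forest (j v m : ℕ) (F : List ℕ) : Set where
    field
      child      : Fin m → ℕ
      subtree    : ∀ c → Tree j (child c) F
      child-edge : ∀ c → T (E G v (child c))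
      disjoint   : ∀ c c′ p q → length p ≤ j → length q ≤ j →
                   label (subtree c) p ≡ label (subtree c′) q → c ≡ c′

  open Forest

  weaken : ∀ {j v F F′} → F ⊆ F′ → Tree j v F′ → Tree j v F
  weaken F⊆F′ t = record
    { label = label t ; root = root t ; avoids = λ p l → avoids t p l ∘ F⊆F′
    ; injective = injective t ; edge = edge t ; leaf = leaf t }

  sprout : ∀ {v F} → T (A 0 v) → v ∉ F → Tree 0 v F
  sprout {v} a v∉F = record
    { label     = λ _ → v
    ; root      = refl
    ; avoids    = λ _ _ → v∉F
    ; injective = λ { [] [] _ _ _ → refl }
    ; edge      = λ _ _ ()
    ; leaf      = λ { [] _ → a }
    }

  plant : ∀ {j v F} → v ∉ F → Forest j v ℓ (v ∷ F) → Tree (suc j) v F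
  plant {j} {v} {F} v∉F f = record
    { label = lab ; root = refl ; avoids = lab-avoids ; injective = lab-injective
    ; edge = lab-edge ; leaf = lab-leaf }
    where
    lab : List (Fin ℓ) → ℕ
    lab []      = v
    lab (c ∷ p) = label (subtree f c) p

    lab-avoids : ∀ p → length p ≤ suc j → lab p ∉ F
    lab-avoids []      _       = v∉F
    lab-avoids (c ∷ p) (s≤s l) = avoids (subtree f c) p l ∘ there

    lab-injective : ∀ p q → length p ≤ suc j → length q ≤ suc j → lab p ≡ lab q → p ≡ q
    lab-injective []      []       _        _        _  = refl
    lab-injective []      (c ∷ q)  _        (s≤s lq) eq = contradiction (here (sym eq)) (avoids (subtree f c) q lq)
    lab-injective (c ∷ p) []       (s≤s lp) _        eq = contradiction (here eq) (avoids (subtree f c) p lp)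
    lab-injective (c ∷ p) (c′ ∷ q) (s≤s lp) (s≤s lq) eq with disjoint f c c′ p q lp lq eq
    ... | refl = cong (c ∷_) (injective (subtree f c) p q lp lq eq)

    lab-edge : ∀ p i → length p < suc j → T (E G (lab p) (lab (p ∷ʳ i)))
    lab-edge []      i _       = subst (T ∘ E G v) (sym (root (subtree f i))) (child-edge f i)
    lab-edge (c ∷ p) i (s≤s l) = edge (subtree f c) p i l

    lab-leaf : ∀ p → length p ≡ suc j → T (A 0 (lab p))
    lab-leaf (c ∷ p) eq = leaf (subtree f c) p (suc-injective eq)

  noForest : ∀ {j v F} → Forest j v 0 F
  noForest = record { child = λ () ; subtree = λ () ; child-edge = λ () ; disjoint = λ () }

  graft : ∀ {j v w m F} (t : Tree j w F) → T (E G v w) → Forest j v m (labels t ++ F) →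
          Forest j v (suc m) F
  graft {j} {v} {w} {m} {F} t e f = record
    { child = children ; subtree = subtrees ; child-edge = child-edges ; disjoint = disjoint′ }
    where
    children : Fin (suc m) → ℕ
    children zero    = w
    children (suc c) = child f c

    subtrees : ∀ c → Tree j (children c) F
    subtrees zero    = t
    subtrees (suc c) = weaken (∈-++⁺ʳ (labels t)) (subtree f c)

    child-edges : ∀ c → T (E G v (children c))
    child-edges zero    = e
    child-edges (suc c) = child-edge f c

    label∈labels : ∀ p → length p ≤ j → label t p ∈ labels t
    label∈labels p l = ∈-map⁺ (label t) (∈-words⁺ p l)

    disjoint′ : ∀ c c′ p q → length p ≤ j → length q ≤ j →
                label (subtrees c) p ≡ label (subtrees c′) q → c ≡ c′
    disjoint′ zero    zero     p q lp lq eq = refl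
    disjoint′ zero    (suc c′) p q lp lq eq =
      contradiction (∈-++⁺ˡ (subst (_∈ labels t) eq (label∈labels p lp))) (avoids (subtree f c′) q lq)
    disjoint′ (suc c) zero     p q lp lq eq =
      contradiction (∈-++⁺ˡ (subst (_∈ labels t) (sym eq) (label∈labels q lq))) (avoids (subtree f c) p lp)
    disjoint′ (suc c) (suc c′) p q lp lq eq = cong suc (disjoint f c c′ p q lp lq eq)

  grow       : ∀ j {v F} → T (A j v) → v ∉ F → length F + length (words ℓ j) ≤ N → Tree j v F
  growForest : ∀ j {v} → T (A (suc j) v) → ∀ m {F} → length F + m * length (words ℓ j) ≤ N →
               Forest j v m F
  grow zero    a v∉F _ = sprout a v∉F
  grow (suc j) {v} {F} a v∉F budget = plant v∉F (growForest j a ℓ budget′)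
    where
    budget′ : length (v ∷ F) + ℓ * length (words ℓ j) ≤ N
    budget′ = subst (_≤ N) (trans (cong (length F +_) (length-words-suc ℓ j)) (+-suc _ _)) budget
  growForest j a zero    _ = noForest
  growForest j {v} a (suc m) {F} budget =
    let w , w∉F , e , aw = fresh-out-neighbour G (A j) v F (<-≤-trans F<N (A-deg j v a))
        t = grow j aw w∉F budget-tree
    in graft t e (growForest j a m (budget-rest t))
    where
    W = length (words ℓ j)
    budget-tree : length F + W ≤ N
    budget-tree = ≤-trans (+-monoʳ-≤ (length F) (m≤m+n W (m * W))) budget
    F<N : length F < N
    F<N = <-≤-trans (m<m+n (length F) (0<length-words ℓ j)) budget-tree
    budget-rest : ∀ {w} (t : Tree j w F) → length (labels t ++ F) + m * W ≤ N
    budget-rest t = subst (_≤ N) (sym (begin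
      length (labels t ++ F) + m * W          ≡⟨ cong (_+ m * W) (length-++ (labels t)) ⟩
      (length (labels t) + length F) + m * W
        ≡⟨ cong (λ n → (n + length F) + m * W) (length-map (label t) (words ℓ j)) ⟩
      (W + length F) + m * W                  ≡⟨ xy∙z≈y∙xz W (length F) (m * W) ⟩
      length F + (W + m * W)                  ∎)) budget
      where open ≡-Reasoning

  embedding : ∀ {k v F} → v ∈ V G → Tree k v F → Embedding k ℓ G
  embedding {k} v∈V t = record
    { vertex    = label t ∘ reverse
    ; root∈V    = subst (_∈ V G) (sym (root t)) v∈V
    ; injective = λ x y lx ly eq →
        reverse-injective (injective t (reverse x) (reverse y) (reverse-≤ x lx) (reverse-≤ y ly) eq)
    ; edge      = λ i x l → subst (λ p → T (E G (label t (reverse x)) (label t p)))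
        (sym (unfold-reverse i x)) (edge t (reverse x) i (reverse-< x l))
    }
    where
    reverse-≤ : ∀ {n} (x : List (Fin ℓ)) → length x ≤ n → length (reverse x) ≤ n
    reverse-≤ x = subst (_≤ _) (sym (length-reverse x))
    reverse-< : ∀ {n} (x : List (Fin ℓ)) → length x < n → length (reverse x) < n
    reverse-< x = subst (_< _) (sym (length-reverse x))

  greedy-copy : ∀ k {v} {L : ℕ → Set} → (∀ u → T (A 0 u) → L u) →
                length (words ℓ k) ≤ N → v ∈ V G → T (A k v) → TreeCopy k ℓ G L
  greedy-copy k {L = L} A0⇒L budget v∈V a = embedding⇒copy {L = L} (embedding v∈V t)
    λ x l → A0⇒L _ (leaf t (reverse x) (trans (length-reverse x) l))
    where
    t : Tree k _ []
    t = grow k a (λ ()) budget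

module Layers (G : Digraph) (N : ℕ) (X : ℕ → Bool) where

  layer : ℕ → ℕ → Bool
  layer zero      = X
  layer (suc j) v = N ≤ᵇ degIn G (layer j) v

  layer-deg : ∀ j v → T (layer (suc j) v) → N ≤ degIn G (layer j) v
  layer-deg j v = ≤ᵇ⇒≤ N _

  layer-sparse : ∀ j v → ¬ T (layer (suc j) v) → degIn G (layer j) v < N
  layer-sparse j v ¬l = ≰⇒> (¬l ∘ ≤⇒≤ᵇ)

  layers : ℕ → ℕ → ℕ → Bool
  layers i zero    v = false
  layers i (suc m) v = layer i v ∨ layers (suc i) m v

  ¬layers-snoc : ∀ i m {v} → ¬ T (layers i m v) → ¬ T (layer (i + m) v) → ¬ T (layers i (suc m) v)
  ¬layers-snoc i zero    {v} _  ¬top l with to (T-∨ {layer i v}) l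
  ... | inj₁ top = ¬top (subst (λ j → T (layer j v)) (sym (+-identityʳ i)) top)
  ¬layers-snoc i (suc m) {v} ¬l ¬top l with to (T-∨ {layer i v}) l
  ... | inj₁ bottom = ¬l (from T-∨ (inj₁ bottom))
  ... | inj₂ rest   = ¬layers-snoc (suc i) m (¬l ∘ from T-∨ ∘ inj₂)
                        (¬top ∘ subst (λ j → T (layer j v)) (sym (+-suc i m))) rest

  ¬layers-shift : ∀ m {v} → ¬ T (layers 0 m v) → ¬ T (layer m v) → ¬ T (layers 1 m v)
  ¬layers-shift zero    _  _    ()
  ¬layers-shift (suc m) ¬l ¬top = ¬layers-snoc 1 m (¬l ∘ from T-∨ ∘ inj₂) ¬top

  layers-bottom : ∀ {i m v} → 1 ≤ m → T (layer i v) → T (layers i m v)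
  layers-bottom {m = suc _} _ l = from T-∨ (inj₁ l)

  degIn-layers : ∀ i m v → ¬ T (layers (suc i) m v) → degIn G (layers i m) v + m ≤ m * N
  degIn-layers i zero    v _  = ≤-reflexive (trans (+-identityʳ _) (degIn-∅ G v))
  degIn-layers i (suc m) v ¬l = begin
    degIn G (layers i (suc m)) v + suc m  ≤⟨ +-monoˡ-≤ (suc m) (degIn-∪ G (layer i) (layers (suc i) m) v) ⟩
    (a + b) + suc m                       ≡⟨ trans (+-suc (a + b) m) (cong suc (+-assoc a b m)) ⟩
    suc a + (b + m)                       ≤⟨ +-mono-≤ (layer-sparse i v (¬l ∘ from T-∨ ∘ inj₁))
                                                      (degIn-layers (suc i) m v (¬l ∘ from T-∨ ∘ inj₂)) ⟩
    N + m * N                             ∎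
    where
    open ≤-Reasoning
    a = degIn G (layer i) v
    b = degIn G (layers (suc i) m) v

  module _ (d k : ℕ) (δ : MinOutDeg≥ G (d + k * N)) where

    escape : ∀ i m {v} → m ≤ k → v ∈ V G → ¬ T (layers (suc i) m v) →
             d + m ≤ degIn G (not ∘ layers i m) v
    escape i m {v} m≤k v∈V ¬l = +-cancelʳ-≤ (k * N) (d + m) b (begin
      (d + m) + k * N   ≡⟨ xy∙z≈xz∙y d m (k * N) ⟩
      (d + k * N) + m   ≤⟨ +-monoˡ-≤ m (proj₂ δ v v∈V) ⟩
      outdeg G v + m    ≤⟨ +-monoˡ-≤ m (outdeg-split G (layers i m) v) ⟩
      (a + b) + m       ≡⟨ xy∙z≈xz∙y a b m ⟩
      (a + m) + b       ≤⟨ +-monoˡ-≤ b (degIn-layers i m v ¬l) ⟩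
      m * N + b         ≤⟨ +-monoˡ-≤ b (*-monoˡ-≤ N m≤k) ⟩
      k * N + b         ≡⟨ +-comm (k * N) b ⟩
      b + k * N         ∎)
      where
      open ≤-Reasoning
      a = degIn G (layers i m) v
      b = degIn G (not ∘ layers i m) v

    module _ (layer-k-empty : ∀ v → v ∈ V G → ¬ T (layer k v)) where

      outside : ∀ i m → i + m ≡ k → ∃[ v ] (v ∈ V G × ¬ T (layers i m v))
      outside i zero    _   = let v , v∈V = nonempty-∈ (proj₁ δ) in v , v∈V , λ ()
      outside i (suc m) i+m≡k =
        let v , v∈V , ¬l = outside (suc i) m 1+i+m≡k
            w , _ , Evw , w-out = fresh-out-neighbour G (not ∘ layers i (suc m)) v [] (escapes v∈V ¬l)
        in w , proj₂ (E-closed G v w Evw) , T-not⁻ w-out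
        where
        1+i+m≡k : suc i + m ≡ k
        1+i+m≡k = trans (sym (+-suc i m)) i+m≡k
        1+m≤k : suc m ≤ k
        1+m≤k = subst (suc m ≤_) i+m≡k (m≤n+m (suc m) i)
        escapes : ∀ {v} → v ∈ V G → ¬ T (layers (suc i) m v) → 0 < degIn G (not ∘ layers i (suc m)) v
        escapes {v} v∈V ¬l = ≤-trans (s≤s z≤n) (≤-trans (m≤n+m (suc m) d)
          (escape i (suc m) 1+m≤k v∈V (¬layers-snoc (suc i) m ¬l ¬top)))
          where
          ¬top = layer-k-empty v v∈V ∘ subst (λ j → T (layer j v)) 1+i+m≡k

      sparse-part : MinOutDeg≥ (induced G (not ∘ layers 0 k)) d
      sparse-part = nonempty , degree
        where
        S = not ∘ layers 0 k
        nonempty : V (induced G S) ≢ []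
        nonempty V≡[] with outside 0 k refl
        ... | v , v∈V , ¬l = contradiction (subst (v ∈_) V≡[] (∈-induced⁺ G S v∈V (T-not⁺ ¬l))) λ ()
        degree : ∀ v → v ∈ V (induced G S) → d ≤ outdeg (induced G S) v
        degree v v∈H with ∈-induced⁻ G S v∈H
        ... | v∈V , v-out = subst (d ≤_) (sym (outdeg-induced G S v-out))
              (≤-trans (m≤m+n d k)
                (escape 0 k ≤-refl v∈V (¬layers-shift k (T-not⁻ v-out) (layer-k-empty v v∈V))))

module _ (P : VertexProperty) (d : ℕ) (common : IsδCommon P d) (k ℓ : ℕ) (k≥1 : 1 ≤ k) (ℓ≥2 : 2 ≤ ℓ)
         (G : Digraph) (δ : MinOutDeg≥ G (d + k * (2 * ℓ ^ k))) where

  open import Data.List.Membership.DecPropositional _≟_ using (_∈?_)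

  module _ (Xs : List ℕ) (Xs⊆P : ∀ v → v ∈ Xs → P G v) where

    open Layers G (2 * ℓ ^ k) (λ v → ⌊ v ∈? Xs ⌋)

    tree-or-new-vertex : TreeCopy k ℓ G (P G) ⊎ ∃[ v ] (v ∈ V G × v ∉ Xs × P G v)
    tree-or-new-vertex with any? (T? ∘ layer k) (V G)
    ... | yes in-layer-k =
          let v , v∈V , a = find in-layer-k in
          inj₁ (Greedy.greedy-copy G ℓ (2 * ℓ ^ k) layer layer-deg k
                  (λ u → Xs⊆P u ∘ toWitness {a? = u ∈? Xs}) (<⇒≤ (length-words-< ℓ≥2 k)) v∈V a)
    ... | no layer-k-empty =
          let H = induced G (not ∘ layers 0 k)
              v , v∈H , Pv = proj₁ common H (sparse-part d k δ (λ v v∈V l → layer-k-empty (lose v∈V l)))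
              v∈V , v-out = ∈-induced⁻ G _ v∈H
          in inj₂ (v , v∈V , (λ v∈Xs → T-not⁻ v-out (layers-bottom k≥1 (fromWitness v∈Xs)))
                   , proj₂ common H G (induced-⊆G G _) v v∈H Pv)

  extend-until-tree : ∀ n (Xs : List ℕ) → Unique Xs → Xs ⊆ V G → (∀ v → v ∈ Xs → P G v) →
                      length (V G) < length Xs + n → TreeCopy k ℓ G (P G)
  extend-until-tree zero Xs uniq Xs⊆V _ bound =
    contradiction (Unique⇒length-≤ _≟_ uniq Xs⊆V) (<⇒≱ (subst (length (V G) <_) (+-identityʳ _) bound))
  extend-until-tree (suc n) Xs uniq Xs⊆V Xs⊆P bound with tree-or-new-vertex Xs Xs⊆P
  ... | inj₁ copy = copy
  ... | inj₂ (v , v∈V , v∉Xs , Pv) =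
        extend-until-tree n (v ∷ Xs) (¬Any⇒All¬ Xs v∉Xs ∷ uniq)
          (λ { (here refl) → v∈V ; (there w∈) → Xs⊆V w∈ })
          (λ { _ (here refl) → Pv ; w (there w∈) → Xs⊆P w w∈ })
          (subst (length (V G) <_) (+-suc (length Xs) n) bound)

theorem3p5 : (P : VertexProperty) (d : ℕ) → IsδCommon P d →
    (k ℓ : ℕ) → 1 ≤ k → 2 ≤ ℓ →
    (G : Digraph) → MinOutDeg≥ G (d + 2 * k * ℓ ^ k) →
    ∃[ B ] (B ⊆G G × ∃[ φ ] (IsIsoFromTree k ℓ B φ × (∀ x → IsLeaf {k} {ℓ} x → P G (φ x))))
theorem3p5 P d common k ℓ k≥1 ℓ≥2 G δ =
  extend-until-tree P d common k ℓ k≥1 ℓ≥2 G δ′ (suc (length (V G))) [] [] (λ ()) (λ _ ()) ≤-refl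
  where
  δ′ : MinOutDeg≥ G (d + k * (2 * ℓ ^ k))
  δ′ = subst (λ m → MinOutDeg≥ G (d + m)) (trans (cong (_* ℓ ^ k) (*-comm 2 k)) (*-assoc k 2 (ℓ ^ k))) δ
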